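{- Let $t$ be a positive integer and let $H$ be a Hadamard matrix of order $8t$ such that every quadruple of distinct rows of $H$ has type $0$ or $t$. Then $H$ is equivalent to the Sylvester Hadamard matrix of order $8t$ (in particular, $8t$ is a power of $2$).
   Context: A Hadamard matrix of order $n$ is an $n\times n$ matrix $H=(h_{uv})$ with entries in $\{ -1,1\}$ such that $HH^\top=nI$. For four distinct rows $i,j,k,\ell$ of $H$, put $P_{ijk\ell}=\left|\sum_{r=1}^n h_{ir}h_{jr}h_{kr}h_{\ell r}\right|$; the type of the quadruple $\{i,j,k,\ell\}$ is $T_{ijk\ell}=\frac{n-P_{ijk\ell}}{8}$. Two Hadamard matrices are equivalent if one can be obtained from the other by a sequence of row negations, row permutations, column negations and column permutations. The Sylvester Hadamard matrices are defined by $\mathsf{H}_1=[1]$ and $\mathsf{H}_{2^r}=\begin{bmatrix}\mathsf{H}_{2^{r-1}}&\mathsf{H}_{2^{r-1}}\\ \mathsf{H}_{2^{r-1}}&-\mathsf{H}_{2^{r-1}}\end{bmatrix}$ for $r\geqslant1$. -}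

module Defs where

open import Data.Nat as ℕ using (ℕ; zero; suc; _∸_; _^_)
open import Data.Integer as ℤ using (ℤ; +_; -_; ∣_∣)
open import Data.Fin using (Fin; splitAt; cast)
open import Data.Fin.Permutation using (Permutation; _⟨$⟩ʳ_)
open import Data.Sum using (_⊎_; inj₁; inj₂)
open import Data.Product using (Σ; ∃; _×_; _,_)
open import Data.Vec.Functional using (Vector)
open import Data.Vec.Functional.Properties using ()
open import Relation.Binary.PropositionalEquality using (_≡_; _≢_)
open import Data.Nat.Properties using (+-identityʳ)
open import Relation.Binary.PropositionalEquality using (sym; cong)

Matrix : ℕ → Set
Matrix n = Fin n → Fin n → ℤ

Σℤ : ∀ {n} → (Fin n → ℤ) → ℤ
Σℤ {zero}  f = + 0
Σℤ {suc n} f = f Fin.zero ℤ.+ Σℤ (λ i → f (Fin.suc i))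
  where import Data.Fin as Fin

IsSign : ℤ → Set
IsSign x = x ≡ + 1 ⊎ x ≡ - (+ 1)

IsHadamard : (n : ℕ) → Matrix n → Set
IsHadamard n H =
  (∀ i j → IsSign (H i j)) ×
  (∀ i j → Σℤ (λ r → H i r ℤ.* H j r) ≡ (if-eq i j))
  where
    open import Data.Fin using (_≟_)
    open import Relation.Nullary using (yes; no)
    if-eq : Fin n → Fin n → ℤ
    if-eq i j with i ≟ j
    ... | yes _ = + n
    ... | no  _ = + 0

P : ∀ {n} → Matrix n → Fin n → Fin n → Fin n → Fin n → ℕ
P H i j k l = ∣ Σℤ (λ r → H i r ℤ.* H j r ℤ.* H k r ℤ.* H l r) ∣

-- "The quadruple {i,j,k,l} has type T", i.e. (n - P_{ijkl}) / 8 = T,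
-- written without division as n - P_{ijkl} = 8 T  (P ≤ n always holds for Hadamard H).
HasType : ∀ {n} → Matrix n → Fin n → Fin n → Fin n → Fin n → ℕ → Set
HasType {n} H i j k l T = n ∸ P H i j k l ≡ 8 ℕ.* T

Distinct4 : ∀ {n} → Fin n → Fin n → Fin n → Fin n → Set
Distinct4 i j k l = i ≢ j × i ≢ k × i ≢ l × j ≢ k × j ≢ l × k ≢ l

-- Equivalence of Hadamard matrices: K is obtained from H by row/column permutations
-- and row/column negations, i.e. K i j = r_i c_j H (σ i) (τ j) with signs r, c.
-- (Allowing different index sizes m, n; a bijection Fin m ↔ Fin n forces m = n.)
Equivalent : ∀ {n m} → Matrix n → Matrix m → Set
Equivalent {n} {m} H K =
  Σ (Permutation m n) λ σ → Σ (Permutation m n) λ τ →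
  Σ (Fin m → ℤ) λ r → Σ (Fin m → ℤ) λ c →
  (∀ i → IsSign (r i)) × (∀ j → IsSign (c j)) ×
  (∀ i j → K i j ≡ r i ℤ.* c j ℤ.* H (σ ⟨$⟩ʳ i) (τ ⟨$⟩ʳ j))

-- Sylvester Hadamard matrix H_{2^k}, defined by the block recursion
-- H_{2^{k+1}} = [[H, H], [H, -H]], splitting Fin (2^(k+1)) = Fin (2^k + 2^k).
2^suc≡ : ∀ k → 2 ^ suc k ≡ 2 ^ k ℕ.+ 2 ^ k
2^suc≡ k = cong (2 ^ k ℕ.+_) (+-identityʳ (2 ^ k))

Sylvester : (k : ℕ) → Matrix (2 ^ k)
Sylvester zero    i j = + 1
Sylvester (suc k) i j
  with splitAt (2 ^ k) (cast (2^suc≡ k) i) | splitAt (2 ^ k) (cast (2^suc≡ k) j)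
... | inj₁ a | inj₁ b = Sylvester k a b
... | inj₁ a | inj₂ b = Sylvester k a b
... | inj₂ a | inj₁ b = Sylvester k a b
... | inj₂ a | inj₂ b = - Sylvester k a b

module Submission where

-- Rescale rows and columns of H by signs to N, whose first row and column consist of ones.
-- For distinct rows i, j, l other than the first, the quadruple {0, i, j, l} has P = n or P = 0:
-- in the first case the entrywise product of rows i and j is row l, in the second it is
-- orthogonal to row l.  As the rows of a Hadamard matrix span, no ±1 vector is orthogonal to all
-- of them, so the rows are closed under entrywise products and form an elementary abelian
-- 2-group of order n = 2^r.  Indexing rows by coordinates over a basis and columns by the signs
-- of the basis rows in them turns N into the Sylvester matrix, whose entries are (-1)^(a·b).

open import Defs
open import Data.Nat as ℕ using (ℕ; zero; suc; _∸_; _^_; z≤n; s≤s)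
import Data.Nat.Properties as ℕP
open import Data.Integer as ℤ using (ℤ; +_; -_; ∣_∣; _+_; _-_; _*_; 0ℤ; 1ℤ; -1ℤ)
import Data.Integer.Properties as ℤP
open import Data.Integer.Solver using (module +-*-Solver)
open import Algebra.Properties.AbelianGroup ℤP.+-0-abelianGroup using () renaming (∙-cancelˡ to +-cancelˡ-≡)
open import Algebra.Properties.Semiring.Sum ℤP.+-*-semiring
  using (sum; sum-cong-≗; sum-remove; sum-replicate-zero; ∑-distrib-+; ∑-comm; *-distribˡ-sum; *-distribʳ-sum)
import Algebra.Properties.Semiring.Sum ℕP.+-*-semiring as ℕΣ
open import Data.Fin using (Fin; zero; suc; punchIn; punchOut; splitAt; join; cast)
open import Data.Fin.Permutation using (Permutation; permutation; _⟨$⟩ʳ_)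
open import Function.Definitions using (Injective)
open import Data.Fin.Properties using (_≟_; punchInᵢ≢i; punchOut-injective; injective⇒≤; ¬∀⟶∃¬; any?; all?; splitAt-join; join-splitAt; cast-trans; cast-is-id)
open import Data.Bool using (Bool; true; false; _xor_)
open import Data.Vec as Vec using (Vec; []; _∷_; zipWith)
open import Data.Sum as Sum using (_⊎_; inj₁; inj₂; [_,_]′)
open import Data.Product using (Σ; ∃; _×_; _,_; proj₁; proj₂; map₂)
open import Data.Empty using (⊥-elim)
open import Function using (_∘_; id)
open import Relation.Nullary using (yes; no; does)
open import Relation.Binary.PropositionalEquality
open ≡-Reasoning

private
  variable
    m n : ℕ

Σℤ≡sum : (f : Fin n → ℤ) → Σℤ f ≡ sum f
Σℤ≡sum {zero}  f = refl
Σℤ≡sum {suc n} f = cong (_+_ (f zero)) (Σℤ≡sum (f ∘ suc))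

sum-neg : (f : Fin n → ℤ) → sum (λ i → - f i) ≡ - sum f
sum-neg {zero}  f = refl
sum-neg {suc n} f = trans (cong (_+_ (- f zero)) (sum-neg (f ∘ suc))) (sym (ℤP.neg-distrib-+ (f zero) _))

sum-delta : (f : Fin (suc n) → ℤ) (i : Fin (suc n)) → (∀ j → j ≢ i → f j ≡ 0ℤ) → sum f ≡ f i
sum-delta {n} f i f≡0 = begin
  sum f                                  ≡⟨ sum-remove {i = i} f ⟩
  f i + sum (λ j → f (punchIn i j))      ≡⟨ cong (_+_ (f i)) (sum-cong-≗ (λ j → f≡0 _ (punchInᵢ≢i i j))) ⟩
  f i + sum {n} (λ _ → 0ℤ)                ≡⟨ cong (_+_ (f i)) (sum-replicate-zero n) ⟩
  f i + 0ℤ                               ≡⟨ ℤP.+-identityʳ (f i) ⟩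
  f i                                    ∎

sum-+ : (g : Fin n → ℕ) → sum (λ i → + g i) ≡ + ℕΣ.sum g
sum-+ {zero}  g = refl
sum-+ {suc n} g = trans (cong (_+_ (+ g zero)) (sum-+ (g ∘ suc))) (sym (ℤP.pos-+ (g zero) _))

sum-+≡0⇒≡0 : (g : Fin n → ℕ) → sum (λ i → + g i) ≡ 0ℤ → ∀ i → g i ≡ 0
sum-+≡0⇒≡0 g e = ℕsum≡0⇒≡0 g (ℤP.+-injective (trans (sym (sum-+ g)) e))
  where
  ℕsum≡0⇒≡0 : ∀ {n} (g : Fin n → ℕ) → ℕΣ.sum g ≡ 0 → ∀ i → g i ≡ 0
  ℕsum≡0⇒≡0 g e zero    = ℕP.m+n≡0⇒m≡0 (g zero) e
  ℕsum≡0⇒≡0 g e (suc i) = ℕsum≡0⇒≡0 (g ∘ suc) (ℕP.m+n≡0⇒n≡0 (g zero) e) i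

infix 8 _·_
infixl 9 _⊙_

_⊙_ : (u v : Fin n → ℤ) → Fin n → ℤ
(u ⊙ v) r = u r * v r

_·_ : (u v : Fin n → ℤ) → ℤ
u · v = sum (λ r → u r * v r)

i*i≡+∣i∣*∣i∣ : ∀ i → i * i ≡ + (∣ i ∣ ℕ.* ∣ i ∣)
i*i≡+∣i∣*∣i∣ (+ zero)    = refl
i*i≡+∣i∣*∣i∣ (+ suc k)   = refl
i*i≡+∣i∣*∣i∣ ℤ.-[1+ k ]  = refl

u·u≡+ : (u : Fin n → ℤ) → u · u ≡ + ℕΣ.sum (λ i → ∣ u i ∣ ℕ.* ∣ u i ∣)
u·u≡+ u = trans (sum-cong-≗ (i*i≡+∣i∣*∣i∣ ∘ u)) (sum-+ (λ i → ∣ u i ∣ ℕ.* ∣ u i ∣))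

u·u≡0⇒u≡0 : (u : Fin n → ℤ) → u · u ≡ 0ℤ → ∀ i → u i ≡ 0ℤ
u·u≡0⇒u≡0 u e i with ℕP.m*n≡0⇒m≡0∨n≡0 ∣ u i ∣ (sum-+≡0⇒≡0 (λ i → ∣ u i ∣ ℕ.* ∣ u i ∣) (trans (sum-cong-≗ (sym ∘ i*i≡+∣i∣*∣i∣ ∘ u)) e) i)
... | inj₁ ∣ui∣≡0 = ℤP.∣i∣≡0⇒i≡0 ∣ui∣≡0
... | inj₂ ∣ui∣≡0 = ℤP.∣i∣≡0⇒i≡0 ∣ui∣≡0

sign*sign≡1 : ∀ {x} → IsSign x → x * x ≡ 1ℤ
sign*sign≡1 (inj₁ refl) = refl
sign*sign≡1 (inj₂ refl) = refl

sign-* : ∀ {x y} → IsSign x → IsSign y → IsSign (x * y)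
sign-* (inj₁ refl) (inj₁ refl) = inj₁ refl
sign-* (inj₁ refl) (inj₂ refl) = inj₂ refl
sign-* (inj₂ refl) (inj₁ refl) = inj₂ refl
sign-* (inj₂ refl) (inj₂ refl) = inj₁ refl

sign-neg : ∀ {x} → IsSign x → IsSign (- x)
sign-neg (inj₁ refl) = inj₂ refl
sign-neg (inj₂ refl) = inj₁ refl

∣sign*i∣≡∣i∣ : ∀ {s} i → IsSign s → ∣ s * i ∣ ≡ ∣ i ∣
∣sign*i∣≡∣i∣ i (inj₁ refl) = cong ∣_∣ (ℤP.*-identityˡ i)
∣sign*i∣≡∣i∣ i (inj₂ refl) = trans (cong ∣_∣ (ℤP.-1*i≡-i i)) (ℤP.∣-i∣≡∣i∣ i)

sign*-involutive : ∀ {s} i → IsSign s → s * (s * i) ≡ i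
sign*-involutive {s} i s± = begin
  s * (s * i)  ≡⟨ ℤP.*-assoc s s i ⟨
  s * s * i    ≡⟨ cong (_* i) (sign*sign≡1 s±) ⟩
  1ℤ * i       ≡⟨ ℤP.*-identityˡ i ⟩
  i            ∎

x*s*s≡x : ∀ {s} x → IsSign s → x * s * s ≡ x
x*s*s≡x {s} x s± = trans (ℤP.*-assoc x s s) (trans (cong (x *_) (sign*sign≡1 s±)) (ℤP.*-identityʳ x))

s*x*s≡x : ∀ {s} x → IsSign s → s * x * s ≡ x
s*x*s≡x {s} x s± = trans (cong (_* s) (ℤP.*-comm s x)) (x*s*s≡x x s±)

x*s≡1⇒x≡s : ∀ {s x} → IsSign s → x * s ≡ 1ℤ → x ≡ s
x*s≡1⇒x≡s {s} {x} s± xs≡1 = trans (sym (x*s*s≡x x s±)) (trans (cong (_* s) xs≡1) (ℤP.*-identityˡ s))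

∣sum-signs∣≤n : {x : Fin n → ℤ} → (∀ i → IsSign (x i)) → ∣ sum x ∣ ℕ.≤ n
∣sum-signs∣≤n {zero}      x± = z≤n
∣sum-signs∣≤n {suc n} {x} x± = ℕP.≤-trans (ℤP.∣i+j∣≤∣i∣+∣j∣ (x zero) _) (∣x₀∣+ (x± zero))
  where
  ∣x₀∣+ : IsSign (x zero) → ∣ x zero ∣ ℕ.+ ∣ sum (x ∘ suc) ∣ ℕ.≤ suc n
  ∣x₀∣+ (inj₁ x₀≡1)  rewrite x₀≡1  = s≤s (∣sum-signs∣≤n (x± ∘ suc))
  ∣x₀∣+ (inj₂ x₀≡-1) rewrite x₀≡-1 = s≤s (∣sum-signs∣≤n (x± ∘ suc))

sum-signs≡n⇒≡1 : {x : Fin n → ℤ} → (∀ i → IsSign (x i)) → sum x ≡ + n → ∀ i → x i ≡ 1ℤ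
sum-signs≡n⇒≡1 {suc n} {x} x± e i with x± zero
... | inj₂ x₀≡-1 = ⊥-elim (ℕP.1+n≰n (ℕP.≤-trans (ℕP.n≤1+n (suc n)) 2+n≤n))
  where
  tail≡2+n : sum (x ∘ suc) ≡ + suc (suc n)
  tail≡2+n = +-cancelˡ-≡ -1ℤ _ _ (subst (λ x₀ → x₀ + sum (x ∘ suc) ≡ + suc n) x₀≡-1 e)
  2+n≤n : suc (suc n) ℕ.≤ n
  2+n≤n = subst (ℕ._≤ n) (cong ∣_∣ tail≡2+n) (∣sum-signs∣≤n (x± ∘ suc))
... | inj₁ x₀≡1 with i
...   | zero  = x₀≡1
...   | suc i = sum-signs≡n⇒≡1 (x± ∘ suc) tail≡n i
  where
  tail≡n : sum (x ∘ suc) ≡ + n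
  tail≡n = +-cancelˡ-≡ 1ℤ _ _ (subst (λ x₀ → x₀ + sum (x ∘ suc) ≡ + suc n) x₀≡1 e)

∣sum-signs∣≡n⇒≡x₀ : {x : Fin (suc n) → ℤ} → (∀ i → IsSign (x i)) → ∣ sum x ∣ ≡ suc n → ∀ i → x i ≡ x zero
∣sum-signs∣≡n⇒≡x₀ {n} {x} x± e i with ℤP.+∣i∣≡i⊎+∣i∣≡-i (sum x)
... | inj₁ +∣s∣≡s  = trans (x≡1 i) (sym (x≡1 zero))
  where
  x≡1 : ∀ i → x i ≡ 1ℤ
  x≡1 = sum-signs≡n⇒≡1 x± (trans (sym +∣s∣≡s) (cong +_ e))
... | inj₂ +∣s∣≡-s = ℤP.neg-injective (trans (-x≡1 i) (sym (-x≡1 zero)))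
  where
  -x≡1 : ∀ i → - x i ≡ 1ℤ
  -x≡1 = sum-signs≡n⇒≡1 (sign-neg ∘ x±) (trans (sum-neg x) (trans (sym +∣s∣≡-s) (cong +_ e)))

-- Orthogonal matrices

δ : (n : ℕ) → Fin n → Fin n → ℤ
δ n i j with i ≟ j
... | yes _ = + n
... | no  _ = 0ℤ

δ-refl : ∀ n (i : Fin n) → δ n i i ≡ + n
δ-refl n i with i ≟ i
... | yes _  = refl
... | no i≢i = ⊥-elim (i≢i refl)

δ-≢ : ∀ n {i j : Fin n} → i ≢ j → δ n i j ≡ 0ℤ
δ-≢ n {i} {j} i≢j with i ≟ j
... | yes i≡j = ⊥-elim (i≢j i≡j)
... | no  _   = refl

δ-sym : ∀ n (i j : Fin n) → δ n i j ≡ δ n j i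
δ-sym n i j with i ≟ j | j ≟ i
... | yes _   | yes _   = refl
... | no  _   | no  _   = refl
... | yes i≡j | no  j≢i = ⊥-elim (j≢i (sym i≡j))
... | no  i≢j | yes j≡i = ⊥-elim (i≢j (sym j≡i))

sum-*δ : ∀ {n} (f : Fin n → ℤ) a → sum (λ b → f b * δ n b a) ≡ f a * + n
sum-*δ {suc n} f a = begin
  sum (λ b → f b * δ (suc n) b a)  ≡⟨ sum-delta (λ b → f b * δ (suc n) b a) a (λ b b≢a → trans (cong (f b *_) (δ-≢ (suc n) b≢a)) (ℤP.*-zeroʳ (f b))) ⟩
  f a * δ (suc n) a a              ≡⟨ cong (f a *_) (δ-refl (suc n) a) ⟩
  f a * + suc n                    ∎

RowsOrthogonal : (n : ℕ) → Matrix n → Set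
RowsOrthogonal n H = ∀ i j → H i · H j ≡ δ n i j

hadamard⇒rowsOrthogonal : ∀ {n} {H : Matrix n} → IsHadamard n H → RowsOrthogonal n H
hadamard⇒rowsOrthogonal {n} {H} (_ , HHᵀ≡nI) i j with i ≟ j | HHᵀ≡nI i j
... | yes _ | e = trans (sym (Σℤ≡sum (λ r → H i r * H j r))) e
... | no  _ | e = trans (sym (Σℤ≡sum (λ r → H i r * H j r))) e

_ᵀ : Matrix n → Matrix n
(H ᵀ) a l = H l a

·-rows-assoc : (H : Matrix n) (v : Fin n → ℤ) (a : Fin n) → sum (λ l → v · H l * H l a) ≡ sum (λ b → v b * ((H ᵀ) b · (H ᵀ) a))
·-rows-assoc H v a = begin
  sum (λ l → sum (λ b → v b * H l b) * H l a)    ≡⟨ sum-cong-≗ (λ l → *-distribʳ-sum (H l a) (λ b → v b * H l b)) ⟩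
  sum (λ l → sum (λ b → v b * H l b * H l a))    ≡⟨ ∑-comm (λ l b → v b * H l b * H l a) ⟩
  sum (λ b → sum (λ l → v b * H l b * H l a))    ≡⟨ sum-cong-≗ (λ b → sum-cong-≗ (λ l → ℤP.*-assoc (v b) (H l b) (H l a))) ⟩
  sum (λ b → sum (λ l → v b * (H l b * H l a)))  ≡⟨ sum-cong-≗ (λ b → *-distribˡ-sum (v b) (λ l → H l b * H l a)) ⟨
  sum (λ b → v b * sum (λ l → H l b * H l a))    ∎

sum-δ* : ∀ {n} (f : Fin n → ℤ) a → sum (λ b → δ n a b * f b) ≡ f a * + n
sum-δ* {n} f a = trans (sum-cong-≗ (λ b → trans (ℤP.*-comm (δ n a b) (f b)) (cong (f b *_) (δ-sym n a b)))) (sum-*δ f a)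

-- The trace argument: D = HᵀH − nI is symmetric with HD = 0, hence D² = −nD; as tr D = 0,
-- the sum of the squares of the entries of D, tr D², vanishes.
module _ {n} (H : Matrix n) (HHᵀ≡nI : RowsOrthogonal n H) where
  private
    D : Matrix n
    D a b = (H ᵀ) a · (H ᵀ) b - δ n a b

    D-sym : ∀ a b → D a b ≡ D b a
    D-sym a b = cong₂ _-_ (sum-cong-≗ (λ l → ℤP.*-comm (H l a) (H l b))) (δ-sym n a b)

    sum-*D : ∀ (v : Fin n → ℤ) a → sum (λ b → v b * D b a) ≡ sum (λ l → v · H l * H l a) - v a * + n
    sum-*D v a = begin
      sum (λ b → v b * D b a)
        ≡⟨ sum-cong-≗ (λ b → ℤP.*-distribˡ-+ (v b) ((H ᵀ) b · (H ᵀ) a) (- δ n b a)) ⟩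
      sum (λ b → v b * ((H ᵀ) b · (H ᵀ) a) + v b * - δ n b a)
        ≡⟨ ∑-distrib-+ (λ b → v b * ((H ᵀ) b · (H ᵀ) a)) (λ b → v b * - δ n b a) ⟩
      sum (λ b → v b * ((H ᵀ) b · (H ᵀ) a)) + sum (λ b → v b * - δ n b a)
        ≡⟨ cong₂ _+_ (sym (·-rows-assoc H v a)) (sum-cong-≗ (λ b → sym (ℤP.neg-distribʳ-* (v b) (δ n b a)))) ⟩
      sum (λ l → v · H l * H l a) + sum (λ b → - (v b * δ n b a))
        ≡⟨ cong (_+_ (sum (λ l → v · H l * H l a))) (trans (sum-neg (λ b → v b * δ n b a)) (cong -_ (sum-*δ v a))) ⟩
      sum (λ l → v · H l * H l a) - v a * + n
        ∎

    HD≡0 : ∀ i a → sum (λ b → H i b * D b a) ≡ 0ℤ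
    HD≡0 i a = begin
      sum (λ b → H i b * D b a)                    ≡⟨ sum-*D (H i) a ⟩
      sum (λ l → H i · H l * H l a) - H i a * + n  ≡⟨ cong (_- H i a * + n) (sum-cong-≗ (λ l → cong (_* H l a) (HHᵀ≡nI i l))) ⟩
      sum (λ l → δ n i l * H l a) - H i a * + n    ≡⟨ cong (_- H i a * + n) (sum-δ* (λ l → H l a) i) ⟩
      H i a * + n - H i a * + n                    ≡⟨ ℤP.+-inverseʳ (H i a * + n) ⟩
      0ℤ                                           ∎

    D·D≡-nD : ∀ a → D a · D a ≡ - (D a a * + n)
    D·D≡-nD a = begin
      sum (λ b → D a b * D a b)                    ≡⟨ sum-cong-≗ (λ b → cong (D a b *_) (D-sym a b)) ⟩
      sum (λ b → D a b * D b a)                    ≡⟨ sum-*D (D a) a ⟩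
      sum (λ l → D a · H l * H l a) - D a a * + n  ≡⟨ cong (_- D a a * + n) (trans (sum-cong-≗ Da·Hl*Hla≡0) (sum-replicate-zero n)) ⟩
      0ℤ - D a a * + n                             ≡⟨ ℤP.+-identityˡ _ ⟩
      - (D a a * + n)                              ∎
      where
      Da·Hl*Hla≡0 : ∀ l → D a · H l * H l a ≡ 0ℤ
      Da·Hl*Hla≡0 l = begin
        sum (λ b → D a b * H l b) * H l a  ≡⟨ cong (_* H l a) (sum-cong-≗ (λ b → trans (ℤP.*-comm (D a b) (H l b)) (cong (H l b *_) (D-sym a b)))) ⟩
        sum (λ b → H l b * D b a) * H l a  ≡⟨ cong (_* H l a) (HD≡0 l a) ⟩
        0ℤ * H l a                         ≡⟨ ℤP.*-zeroˡ (H l a) ⟩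
        0ℤ                                 ∎

    trace-D≡0 : sum (λ a → D a a) ≡ 0ℤ
    trace-D≡0 = begin
      sum (λ a → (H ᵀ) a · (H ᵀ) a + - δ n a a)                ≡⟨ ∑-distrib-+ (λ a → (H ᵀ) a · (H ᵀ) a) (λ a → - δ n a a) ⟩
      sum (λ a → (H ᵀ) a · (H ᵀ) a) + sum (λ a → - δ n a a)    ≡⟨ cong₂ _+_ (∑-comm (λ a l → H l a * H l a)) (sum-neg (λ a → δ n a a)) ⟩
      sum (λ l → H l · H l) - sum (λ a → δ n a a)              ≡⟨ cong (_- sum (λ a → δ n a a)) (sum-cong-≗ (λ l → HHᵀ≡nI l l)) ⟩
      sum (λ a → δ n a a) - sum (λ a → δ n a a)                ≡⟨ ℤP.+-inverseʳ (sum (λ a → δ n a a)) ⟩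
      0ℤ                                                       ∎

    trace-D²≡0 : sum (λ a → D a · D a) ≡ 0ℤ
    trace-D²≡0 = begin
      sum (λ a → D a · D a)         ≡⟨ sum-cong-≗ D·D≡-nD ⟩
      sum (λ a → - (D a a * + n))   ≡⟨ sum-neg (λ a → D a a * + n) ⟩
      - sum (λ a → D a a * + n)     ≡⟨ cong -_ (*-distribʳ-sum (+ n) (λ a → D a a)) ⟨
      - (sum (λ a → D a a) * + n)   ≡⟨ cong (λ t → - (t * + n)) trace-D≡0 ⟩
      0ℤ                            ∎

    D≡0 : ∀ a b → D a b ≡ 0ℤ
    D≡0 a = u·u≡0⇒u≡0 (D a) (trans (u·u≡+ (D a)) (cong +_ (sum-+≡0⇒≡0 _ Σ+≡0 a)))
      where
      Σ+≡0 : sum (λ a → + ℕΣ.sum (λ b → ∣ D a b ∣ ℕ.* ∣ D a b ∣)) ≡ 0ℤ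
      Σ+≡0 = trans (sum-cong-≗ (sym ∘ u·u≡+ ∘ D)) trace-D²≡0

  rowsOrthogonal-ᵀ : RowsOrthogonal n (H ᵀ)
  rowsOrthogonal-ᵀ a b = ℤP.i-j≡0⇒i≡j _ _ (D≡0 a b)

rowsOrthogonal⇒injective : ∀ {m} {H : Matrix (suc m)} → RowsOrthogonal (suc m) H →
                           ∀ {i j} → (∀ c → H i c ≡ H j c) → i ≡ j
rowsOrthogonal⇒injective {m} {H} orth {i} {j} Hi≗Hj with i ≟ j
... | yes i≡j = i≡j
... | no  i≢j = ⊥-elim (n≢0 (begin
  + suc m     ≡⟨ δ-refl (suc m) i ⟨
  δ (suc m) i i  ≡⟨ orth i i ⟨
  H i · H i   ≡⟨ sum-cong-≗ (λ c → cong (H i c *_) (Hi≗Hj c)) ⟩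
  H i · H j   ≡⟨ orth i j ⟩
  δ (suc m) i j  ≡⟨ δ-≢ (suc m) i≢j ⟩
  0ℤ          ∎))
  where
  n≢0 : + suc m ≢ 0ℤ
  n≢0 ()

orthogonal-to-rows⇒≡0 : ∀ {m} {H : Matrix (suc m)} → RowsOrthogonal (suc m) (H ᵀ) →
                        (v : Fin (suc m) → ℤ) → (∀ l → v · H l ≡ 0ℤ) → ∀ a → v a ≡ 0ℤ
orthogonal-to-rows⇒≡0 {m} {H} HᵀH≡nI v v⊥H a with ℤP.i*j≡0⇒i≡0∨j≡0 (v a) va*n≡0
  where
  va*n≡0 : v a * + suc m ≡ 0ℤ
  va*n≡0 = begin
    v a * + suc m                              ≡⟨ sum-*δ v a ⟨
    sum (λ b → v b * δ (suc m) b a)            ≡⟨ sum-cong-≗ (λ b → cong (v b *_) (HᵀH≡nI b a)) ⟨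
    sum (λ b → v b * ((H ᵀ) b · (H ᵀ) a))      ≡⟨ ·-rows-assoc H v a ⟨
    sum (λ l → v · H l * H l a)                ≡⟨ sum-cong-≗ (λ l → trans (cong (_* H l a) (v⊥H l)) (ℤP.*-zeroˡ (H l a))) ⟩
    sum {suc m} (λ _ → 0ℤ)                     ≡⟨ sum-replicate-zero (suc m) ⟩
    0ℤ                                         ∎
... | inj₁ va≡0 = va≡0
... | inj₂ ()

rescale : (ρ γ : Fin n → ℤ) → Matrix n → Matrix n
rescale ρ γ H i j = ρ i * γ j * H i j

module _ {n} {ρ γ : Fin n → ℤ} (ρ± : ∀ i → IsSign (ρ i)) (γ± : ∀ j → IsSign (γ j)) where
  open +-*-Solver

  rescale-sign : {H : Matrix n} → (∀ i j → IsSign (H i j)) → ∀ i j → IsSign (rescale ρ γ H i j)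
  rescale-sign H± i j = sign-* (sign-* (ρ± i) (γ± j)) (H± i j)

  rescale-rowsOrthogonal : {H : Matrix n} → RowsOrthogonal n H → RowsOrthogonal n (rescale ρ γ H)
  rescale-rowsOrthogonal {H} orth i j = begin
    sum (λ r → ρ i * γ r * H i r * (ρ j * γ r * H j r))  ≡⟨ sum-cong-≗ term ⟩
    sum (λ r → ρ i * ρ j * (H i r * H j r))              ≡⟨ *-distribˡ-sum (ρ i * ρ j) (λ r → H i r * H j r) ⟨
    ρ i * ρ j * (H i · H j)                              ≡⟨ cong (ρ i * ρ j *_) (orth i j) ⟩
    ρ i * ρ j * δ n i j                                  ≡⟨ sign²*δ ⟩
    δ n i j                                              ∎
    where
    term : ∀ r → ρ i * γ r * H i r * (ρ j * γ r * H j r) ≡ ρ i * ρ j * (H i r * H j r)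
    term r = begin
      ρ i * γ r * H i r * (ρ j * γ r * H j r)    ≡⟨ solve 5 (λ a b c x y → a :* c :* x :* (b :* c :* y) := (a :* b) :* (x :* y) :* (c :* c))
                                                         refl (ρ i) (ρ j) (γ r) (H i r) (H j r) ⟩
      ρ i * ρ j * (H i r * H j r) * (γ r * γ r)  ≡⟨ cong (ρ i * ρ j * (H i r * H j r) *_) (sign*sign≡1 (γ± r)) ⟩
      ρ i * ρ j * (H i r * H j r) * 1ℤ           ≡⟨ ℤP.*-identityʳ _ ⟩
      ρ i * ρ j * (H i r * H j r)                ∎
    sign²*δ : ρ i * ρ j * δ n i j ≡ δ n i j
    sign²*δ with i ≟ j
    ... | yes refl = trans (cong (_* + n) (sign*sign≡1 (ρ± i))) (ℤP.*-identityˡ (+ n))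
    ... | no  _    = ℤP.*-zeroʳ (ρ i * ρ j)

  P-rescale : (H : Matrix n) (i j k l : Fin n) → P (rescale ρ γ H) i j k l ≡ P H i j k l
  P-rescale H i j k l = begin
    ∣ Σℤ (λ r → R i r * R j r * R k r * R l r) ∣  ≡⟨ cong ∣_∣ (Σℤ≡sum (λ r → R i r * R j r * R k r * R l r)) ⟩
    ∣ sum (λ r → R i r * R j r * R k r * R l r) ∣ ≡⟨ cong ∣_∣ (sum-cong-≗ term) ⟩
    ∣ sum (λ r → ρijkl * Hijkl r) ∣               ≡⟨ cong ∣_∣ (*-distribˡ-sum ρijkl Hijkl) ⟨
    ∣ ρijkl * sum Hijkl ∣                         ≡⟨ ∣sign*i∣≡∣i∣ (sum Hijkl) (sign-* (sign-* (sign-* (ρ± i) (ρ± j)) (ρ± k)) (ρ± l)) ⟩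
    ∣ sum Hijkl ∣                                 ≡⟨ cong ∣_∣ (Σℤ≡sum Hijkl) ⟨
    ∣ Σℤ Hijkl ∣                                  ∎
    where
    R : Matrix n
    R = rescale ρ γ H
    ρijkl : ℤ
    ρijkl = ρ i * ρ j * ρ k * ρ l
    Hijkl : Fin n → ℤ
    Hijkl r = H i r * H j r * H k r * H l r
    term : ∀ r → R i r * R j r * R k r * R l r ≡ ρijkl * Hijkl r
    term r = begin
      R i r * R j r * R k r * R l r
        ≡⟨ solve 9 (λ a b c d g w x y z → a :* g :* w :* (b :* g :* x) :* (c :* g :* y) :* (d :* g :* z)
                                         := (a :* b :* c :* d) :* (w :* x :* y :* z) :* ((g :* g) :* (g :* g)))
                 refl (ρ i) (ρ j) (ρ k) (ρ l) (γ r) (H i r) (H j r) (H k r) (H l r) ⟩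
      ρijkl * Hijkl r * (γ r * γ r * (γ r * γ r))
        ≡⟨ cong (λ g² → ρijkl * Hijkl r * (g² * g²)) (sign*sign≡1 (γ± r)) ⟩
      ρijkl * Hijkl r * 1ℤ
        ≡⟨ ℤP.*-identityʳ _ ⟩
      ρijkl * Hijkl r
        ∎

  Equivalent-rescale : ∀ {m} {H : Matrix n} {K : Matrix m} → Equivalent (rescale ρ γ H) K → Equivalent H K
  Equivalent-rescale {H = H} (σ , τ , r , c , r± , c± , K≡) =
    σ , τ , (λ i → r i * ρ (σ ⟨$⟩ʳ i)) , (λ j → c j * γ (τ ⟨$⟩ʳ j)) ,
    (λ i → sign-* (r± i) (ρ± _)) , (λ j → sign-* (c± j) (γ± _)) ,
    λ i j → trans (K≡ i j) (solve 5 (λ a b x y h → a :* b :* (x :* y :* h) := a :* x :* (b :* y) :* h)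
                                    refl (r i) (c j) (ρ (σ ⟨$⟩ʳ i)) (γ (τ ⟨$⟩ʳ j)) (H (σ ⟨$⟩ʳ i) (τ ⟨$⟩ʳ j)))

-- Normalized Hadamard matrices

record IsNormalizedHadamard {m} (N : Matrix (suc m)) : Set where
  field
    sign            : ∀ i j → IsSign (N i j)
    rowsOrthogonal  : RowsOrthogonal (suc m) N
    first-row       : ∀ j → N zero j ≡ 1ℤ
    first-column    : ∀ i → N i zero ≡ 1ℤ

normalize : Matrix (suc m) → Matrix (suc m)
normalize H = rescale (λ i → H i zero) (λ j → H zero zero * H zero j) H

module _ {m} {H : Matrix (suc m)} (H± : ∀ i j → IsSign (H i j)) where
  open +-*-Solver

  private
    ρ± : ∀ i → IsSign (H i zero)
    ρ± i = H± i zero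
    γ± : ∀ j → IsSign (H zero zero * H zero j)
    γ± j = sign-* (H± zero zero) (H± zero j)

  normalize-isNormalizedHadamard : RowsOrthogonal (suc m) H → IsNormalizedHadamard (normalize H)
  normalize-isNormalizedHadamard orth = record
    { sign           = rescale-sign ρ± γ± H±
    ; rowsOrthogonal = rescale-rowsOrthogonal ρ± γ± {H = H} orth
    ; first-row      = λ j → trans (solve 2 (λ a b → a :* (a :* b) :* b := (a :* a) :* (b :* b)) refl (H zero zero) (H zero j))
                                   (cong₂ _*_ (sign*sign≡1 (H± zero zero)) (sign*sign≡1 (H± zero j)))
    ; first-column   = λ i → trans (solve 2 (λ a b → a :* (b :* b) :* a := (a :* a) :* (b :* b)) refl (H i zero) (H zero zero))
                                   (cong₂ _*_ (sign*sign≡1 (H± i zero)) (sign*sign≡1 (H± zero zero)))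
    }

  normalize-P : ∀ i j k l → P (normalize H) i j k l ≡ P H i j k l
  normalize-P = P-rescale ρ± γ± H

  normalize-Equivalent : ∀ {n} {K : Matrix n} → Equivalent (normalize H) K → Equivalent H K
  normalize-Equivalent = Equivalent-rescale ρ± γ± {H = H}

RowsClosed : Matrix n → Set
RowsClosed N = ∀ i j → ∃ λ l → N i ⊙ N j ≗ N l

module NormalizedHadamard {m} {N : Matrix (suc m)} (isNH : IsNormalizedHadamard N) where
  open IsNormalizedHadamard isNH public

  columnsOrthogonal : RowsOrthogonal (suc m) (N ᵀ)
  columnsOrthogonal = rowsOrthogonal-ᵀ N rowsOrthogonal

  rows-injective : ∀ {i j} → (∀ c → N i c ≡ N j c) → i ≡ j
  rows-injective = rowsOrthogonal⇒injective rowsOrthogonal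

  columns-injective : ∀ {a b} → (∀ l → N l a ≡ N l b) → a ≡ b
  columns-injective = rowsOrthogonal⇒injective {H = N ᵀ} columnsOrthogonal

  row-sum≡0 : ∀ {j} → j ≢ zero → sum (N j) ≡ 0ℤ
  row-sum≡0 {j} j≢0 = begin
    sum (N j)      ≡⟨ sum-cong-≗ (λ c → trans (sym (ℤP.*-identityʳ (N j c))) (cong (N j c *_) (sym (first-row c)))) ⟩
    N j · N zero   ≡⟨ rowsOrthogonal j zero ⟩
    δ (suc m) j zero  ≡⟨ δ-≢ (suc m) j≢0 ⟩
    0ℤ             ∎

  P-first-row : ∀ i j l → P N zero i j l ≡ ∣ (N i ⊙ N j) · N l ∣
  P-first-row i j l = cong ∣_∣ (begin
    Σℤ (λ c → N zero c * N i c * N j c * N l c)  ≡⟨ Σℤ≡sum (λ c → N zero c * N i c * N j c * N l c) ⟩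
    sum (λ c → N zero c * N i c * N j c * N l c) ≡⟨ sum-cong-≗ (λ c → cong (λ x → x * N i c * N j c * N l c) (first-row c)) ⟩
    sum (λ c → 1ℤ * N i c * N j c * N l c)       ≡⟨ sum-cong-≗ (λ c → cong (λ x → x * N j c * N l c) (ℤP.*-identityˡ (N i c))) ⟩
    sum (λ c → N i c * N j c * N l c)            ∎)

  module _ (P∈ : ∀ i j l → Distinct4 zero i j l → P N zero i j l ≡ suc m ⊎ P N zero i j l ≡ 0) where

    product-⊥-or-row : ∀ {i j} → i ≢ zero → j ≢ zero → i ≢ j → ∀ l → (N i ⊙ N j) · N l ≡ 0ℤ ⊎ N i ⊙ N j ≗ N l
    product-⊥-or-row {i} {j} i≢0 j≢0 i≢j l with l ≟ zero | l ≟ i | l ≟ j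
    ... | yes refl | _        | _        = inj₁ (begin
      sum (λ c → N i c * N j c * N zero c)  ≡⟨ sum-cong-≗ (λ c → trans (cong (N i c * N j c *_) (first-row c)) (ℤP.*-identityʳ (N i c * N j c))) ⟩
      N i · N j                             ≡⟨ rowsOrthogonal i j ⟩
      δ (suc m) i j                         ≡⟨ δ-≢ (suc m) i≢j ⟩
      0ℤ                                    ∎)
    ... | no _     | yes refl | _        = inj₁ (trans (sum-cong-≗ (λ c → s*x*s≡x (N j c) (sign i c))) (row-sum≡0 j≢0))
    ... | no _     | no _     | yes refl = inj₁ (trans (sum-cong-≗ (λ c → x*s*s≡x (N i c) (sign j c))) (row-sum≡0 i≢0))
    ... | no l≢0   | no l≢i   | no l≢j
          with P∈ i j l (i≢0 ∘ sym , j≢0 ∘ sym , l≢0 ∘ sym , i≢j , l≢i ∘ sym , l≢j ∘ sym)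
    ...   | inj₂ P≡0 = inj₁ (ℤP.∣i∣≡0⇒i≡0 (trans (sym (P-first-row i j l)) P≡0))
    ...   | inj₁ P≡n = inj₂ (λ c → x*s≡1⇒x≡s (sign l c) (trans (terms≡ c) term₀≡1))
      where
      terms≡ : ∀ c → N i c * N j c * N l c ≡ N i zero * N j zero * N l zero
      terms≡ = ∣sum-signs∣≡n⇒≡x₀ (λ c → sign-* (sign-* (sign i c) (sign j c)) (sign l c)) (trans (sym (P-first-row i j l)) P≡n)
      term₀≡1 : N i zero * N j zero * N l zero ≡ 1ℤ
      term₀≡1 = cong₂ _*_ (cong₂ _*_ (first-column i) (first-column j)) (first-column l)

    -- A product of rows orthogonal to every row would vanish, but it is 1 in the first column.
    rowsClosed : RowsClosed N
    rowsClosed i j with i ≟ zero | j ≟ zero | i ≟ j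
    ... | yes refl | _        | _        = j , λ c → trans (cong (_* N j c) (first-row c)) (ℤP.*-identityˡ (N j c))
    ... | no _     | yes refl | _        = i , λ c → trans (cong (N i c *_) (first-row c)) (ℤP.*-identityʳ (N i c))
    ... | no _     | no _     | yes refl = zero , λ c → trans (sign*sign≡1 (sign i c)) (sym (first-row c))
    ... | no i≢0   | no j≢0   | no i≢j with any? (λ l → all? (λ c → (N i ⊙ N j) c ℤP.≟ N l c))
    ...   | yes product≡row = product≡row
    ...   | no  product≢row = ⊥-elim (1≢0 (trans (sym product₀≡1) (orthogonal-to-rows⇒≡0 {H = N} columnsOrthogonal (N i ⊙ N j) product⊥N zero)))
      where
      1≢0 : 1ℤ ≢ 0ℤ
      1≢0 ()
      product₀≡1 : N i zero * N j zero ≡ 1ℤ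
      product₀≡1 = cong₂ _*_ (first-column i) (first-column j)
      product⊥N : ∀ l → (N i ⊙ N j) · N l ≡ 0ℤ
      product⊥N l = [ id , (λ product≡Nl → ⊥-elim (product≢row (l , product≡Nl))) ]′ (product-⊥-or-row i≢0 j≢0 i≢j l)

-- Indices of the Sylvester matrix as bit strings

half : ∀ {k} → Bool → Fin k → Fin k ⊎ Fin k
half false = inj₁
half true  = inj₂

encode : ∀ {k} → Vec Bool k → Fin (2 ^ k)
encode {zero}  []      = zero
encode {suc k} (b ∷ a) = cast (sym (2^suc≡ k)) (join (2 ^ k) (2 ^ k) (half b (encode a)))

split : ∀ k → Fin (2 ^ suc k) → Fin (2 ^ k) ⊎ Fin (2 ^ k)
split k i = splitAt (2 ^ k) (cast (2^suc≡ k) i)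

decode : ∀ k → Fin (2 ^ k) → Vec Bool k
decode zero    i = []
decode (suc k) i with split k i
... | inj₁ x = false ∷ decode k x
... | inj₂ x = true ∷ decode k x

split-encode : ∀ {k} b (a : Vec Bool k) → split k (encode (b ∷ a)) ≡ half b (encode a)
split-encode {k} b a = begin
  splitAt (2 ^ k) (cast (2^suc≡ k) (cast (sym (2^suc≡ k)) (join (2 ^ k) (2 ^ k) (half b (encode a)))))
    ≡⟨ cong (splitAt (2 ^ k)) (trans (cast-trans (sym (2^suc≡ k)) (2^suc≡ k) _) (cast-is-id refl _)) ⟩
  splitAt (2 ^ k) (join (2 ^ k) (2 ^ k) (half b (encode a)))
    ≡⟨ splitAt-join (2 ^ k) (2 ^ k) (half b (encode a)) ⟩
  half b (encode a)
    ∎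

decode-encode : ∀ {k} (a : Vec Bool k) → decode k (encode a) ≡ a
decode-encode {zero}  []      = refl
decode-encode {suc k} (b ∷ a) with split k (encode (b ∷ a)) | split-encode b a
decode-encode {suc k} (false ∷ a) | _ | refl = cong (false ∷_) (decode-encode a)
decode-encode {suc k} (true ∷ a)  | _ | refl = cong (true ∷_) (decode-encode a)

cast-join-split : ∀ k (i : Fin (2 ^ suc k)) → cast (sym (2^suc≡ k)) (join (2 ^ k) (2 ^ k) (split k i)) ≡ i
cast-join-split k i = begin
  cast (sym (2^suc≡ k)) (join (2 ^ k) (2 ^ k) (splitAt (2 ^ k) (cast (2^suc≡ k) i)))
    ≡⟨ cong (cast (sym (2^suc≡ k))) (join-splitAt (2 ^ k) (2 ^ k) (cast (2^suc≡ k) i)) ⟩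
  cast (sym (2^suc≡ k)) (cast (2^suc≡ k) i)
    ≡⟨ cast-trans (2^suc≡ k) (sym (2^suc≡ k)) i ⟩
  cast (trans (2^suc≡ k) (sym (2^suc≡ k))) i
    ≡⟨ cast-is-id refl i ⟩
  i ∎

encode-decode : ∀ k (i : Fin (2 ^ k)) → encode (decode k i) ≡ i
encode-decode zero    zero = refl
encode-decode (suc k) i with split k i in split≡
... | inj₁ x rewrite encode-decode k x = subst (λ s → cast (sym (2^suc≡ k)) (join (2 ^ k) (2 ^ k) s) ≡ i) split≡ (cast-join-split k i)
... | inj₂ x rewrite encode-decode k x = subst (λ s → cast (sym (2^suc≡ k)) (join (2 ^ k) (2 ^ k) s) ≡ i) split≡ (cast-join-split k i)

walsh : ∀ {k} → Vec Bool k → Vec Bool k → ℤ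
walsh []          []          = 1ℤ
walsh (true ∷ a)  (true ∷ b)  = - walsh a b
walsh (true ∷ a)  (false ∷ b) = walsh a b
walsh (false ∷ a) (_ ∷ b)     = walsh a b

walsh-xor : ∀ {k} (a b p : Vec Bool k) → walsh (zipWith _xor_ a b) p ≡ walsh a p * walsh b p
walsh-xor []          []          []          = refl
walsh-xor (false ∷ a) (false ∷ b) (z ∷ p)     = walsh-xor a b p
walsh-xor (false ∷ a) (true ∷ b)  (false ∷ p) = walsh-xor a b p
walsh-xor (false ∷ a) (true ∷ b)  (true ∷ p)  = trans (cong -_ (walsh-xor a b p)) (ℤP.neg-distribʳ-* (walsh a p) (walsh b p))
walsh-xor (true ∷ a)  (false ∷ b) (false ∷ p) = walsh-xor a b p
walsh-xor (true ∷ a)  (false ∷ b) (true ∷ p)  = trans (cong -_ (walsh-xor a b p)) (ℤP.neg-distribˡ-* (walsh a p) (walsh b p))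
walsh-xor (true ∷ a)  (true ∷ b)  (false ∷ p) = walsh-xor a b p
walsh-xor (true ∷ a)  (true ∷ b)  (true ∷ p)  = trans (walsh-xor a b p) (sym (-i*-j≡i*j (walsh a p) (walsh b p)))
  where
  -i*-j≡i*j : ∀ i j → - i * - j ≡ i * j
  -i*-j≡i*j i j = begin
    - i * - j    ≡⟨ ℤP.neg-distribˡ-* i (- j) ⟨
    - (i * - j)  ≡⟨ cong -_ (ℤP.neg-distribʳ-* i j) ⟨
    - - (i * j)  ≡⟨ ℤP.neg-involutive (i * j) ⟩
    i * j        ∎

sylvesterBlocks : ∀ {m} → Matrix m → Fin m ⊎ Fin m → Fin m ⊎ Fin m → ℤ
sylvesterBlocks S (inj₂ a) (inj₂ b) = - S a b
sylvesterBlocks S (inj₁ a) (inj₁ b) = S a b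
sylvesterBlocks S (inj₁ a) (inj₂ b) = S a b
sylvesterBlocks S (inj₂ a) (inj₁ b) = S a b

Sylvester-suc : ∀ k i j → Sylvester (suc k) i j ≡ sylvesterBlocks (Sylvester k) (split k i) (split k j)
Sylvester-suc k i j with split k i | split k j
... | inj₁ a | inj₁ b = refl
... | inj₁ a | inj₂ b = refl
... | inj₂ a | inj₁ b = refl
... | inj₂ a | inj₂ b = refl

Sylvester-encode : ∀ {k} (a b : Vec Bool k) → Sylvester k (encode a) (encode b) ≡ walsh a b
Sylvester-encode {zero}  []      []      = refl
Sylvester-encode {suc k} (x ∷ a) (y ∷ b) = begin
  Sylvester (suc k) (encode (x ∷ a)) (encode (y ∷ b))
    ≡⟨ Sylvester-suc k (encode (x ∷ a)) (encode (y ∷ b)) ⟩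
  sylvesterBlocks (Sylvester k) (split k (encode (x ∷ a))) (split k (encode (y ∷ b)))
    ≡⟨ cong₂ (sylvesterBlocks (Sylvester k)) (split-encode x a) (split-encode y b) ⟩
  sylvesterBlocks (Sylvester k) (half x (encode a)) (half y (encode b))
    ≡⟨ blocks x y ⟩
  walsh (x ∷ a) (y ∷ b)
    ∎
  where
  blocks : ∀ x y → sylvesterBlocks (Sylvester k) (half x (encode a)) (half y (encode b)) ≡ walsh (x ∷ a) (y ∷ b)
  blocks false false = Sylvester-encode a b
  blocks false true  = Sylvester-encode a b
  blocks true  false = Sylvester-encode a b
  blocks true  true  = cong -_ (Sylvester-encode a b)

n<2^n : ∀ n → n ℕ.< 2 ^ n
n<2^n zero    = s≤s z≤n
n<2^n (suc n) = ℕP.≤-trans (s≤s (n<2^n n)) (ℕP.+-mono-≤ (ℕP.m^n>0 2 n) (ℕP.m≤m+n (2 ^ n) 0))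

injective⇒surjective : ∀ {m n} {f : Fin m → Fin n} → Injective _≡_ _≡_ f → n ℕ.≤ m → ∀ y → ∃ λ x → f x ≡ y
injective⇒surjective {m} {suc n} {f} f-inj n≤m y with any? (λ x → f x ≟ y)
... | yes hit  = hit
... | no  miss = ⊥-elim (ℕP.1+n≰n (ℕP.≤-trans n≤m (injective⇒≤ g-inj)))
  where
  y≢f : ∀ x → y ≢ f x
  y≢f x y≡fx = miss (x , sym y≡fx)
  g-inj : Injective _≡_ _≡_ (λ x → punchOut (y≢f x))
  g-inj e = f-inj (punchOut-injective (y≢f _) (y≢f _) e)

module RowGroup {m} {N : Matrix (suc m)} (isNH : IsNormalizedHadamard N) (closed : RowsClosed N) where
  open NormalizedHadamard isNH

  infixr 7 _∙_

  _∙_ : Fin (suc m) → Fin (suc m) → Fin (suc m)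
  i ∙ j = proj₁ (closed i j)

  ∙-row : ∀ i j → N i ⊙ N j ≗ N (i ∙ j)
  ∙-row i j = proj₂ (closed i j)

  ∙-cancelˡ : ∀ g {i j} → g ∙ i ≡ g ∙ j → i ≡ j
  ∙-cancelˡ g {i} {j} e = rows-injective λ c → begin
    N i c                    ≡⟨ sign*-involutive (N i c) (sign g c) ⟨
    N g c * (N g c * N i c)  ≡⟨ cong (N g c *_) (∙-row g i c) ⟩
    N g c * N (g ∙ i) c      ≡⟨ cong (λ l → N g c * N l c) e ⟩
    N g c * N (g ∙ j) c      ≡⟨ cong (N g c *_) (∙-row g j c) ⟨
    N g c * (N g c * N j c)  ≡⟨ sign*-involutive (N j c) (sign g c) ⟩
    N j c                    ∎

  span : ∀ {k} → Vec (Fin (suc m)) k → Vec Bool k → Fin (suc m)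
  span []       []          = zero
  span (g ∷ gs) (false ∷ a) = span gs a
  span (g ∷ gs) (true ∷ a)  = g ∙ span gs a

  columnBits : ∀ {k} → Vec (Fin (suc m)) k → Fin (suc m) → Vec Bool k
  columnBits gs c = Vec.map (λ g → does (N g c ℤP.≟ -1ℤ)) gs

  span-entry : ∀ {k} (gs : Vec (Fin (suc m)) k) a c → N (span gs a) c ≡ walsh a (columnBits gs c)
  span-entry []       []          c = first-row c
  span-entry (g ∷ gs) (false ∷ a) c = span-entry gs a c
  span-entry (g ∷ gs) (true ∷ a)  c = begin
    N (g ∙ span gs a) c                       ≡⟨ ∙-row g (span gs a) c ⟨
    N g c * N (span gs a) c                   ≡⟨ cong (N g c *_) (span-entry gs a c) ⟩
    N g c * walsh a (columnBits gs c)         ≡⟨ sign*walsh (sign g c) ⟩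
    walsh (true ∷ a) (columnBits (g ∷ gs) c)  ∎
    where
    sign*walsh : ∀ {x} → IsSign x → x * walsh a (columnBits gs c) ≡ walsh (true ∷ a) (does (x ℤP.≟ -1ℤ) ∷ columnBits gs c)
    sign*walsh (inj₁ refl) = ℤP.*-identityˡ _
    sign*walsh (inj₂ refl) = ℤP.-1*i≡-i _

  span-xor : ∀ {k} (gs : Vec (Fin (suc m)) k) a b → N (span gs a) ⊙ N (span gs b) ≗ N (span gs (zipWith _xor_ a b))
  span-xor gs a b c = begin
    N (span gs a) c * N (span gs b) c                      ≡⟨ cong₂ _*_ (span-entry gs a c) (span-entry gs b c) ⟩
    walsh a (columnBits gs c) * walsh b (columnBits gs c)  ≡⟨ walsh-xor a b (columnBits gs c) ⟨
    walsh (zipWith _xor_ a b) (columnBits gs c)            ≡⟨ span-entry gs (zipWith _xor_ a b) c ⟨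
    N (span gs (zipWith _xor_ a b)) c                      ∎

  Independent : ∀ {k} → Vec (Fin (suc m)) k → Set
  Independent gs = ∀ {a b} → span gs a ≡ span gs b → a ≡ b

  Spanning : ∀ {k} → Vec (Fin (suc m)) k → Set
  Spanning gs = ∀ i → ∃ λ a → span gs a ≡ i

  span-xor-∙ : ∀ {k} (gs : Vec (Fin (suc m)) k) {g a b} → span gs a ≡ g ∙ span gs b → span gs (zipWith _xor_ a b) ≡ g
  span-xor-∙ gs {g} {a} {b} e = rows-injective λ c → begin
    N (span gs (zipWith _xor_ a b)) c          ≡⟨ span-xor gs a b c ⟨
    N (span gs a) c * N (span gs b) c          ≡⟨ cong (λ l → N l c * N (span gs b) c) e ⟩
    N (g ∙ span gs b) c * N (span gs b) c      ≡⟨ cong (_* N (span gs b) c) (∙-row g (span gs b) c) ⟨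
    N g c * N (span gs b) c * N (span gs b) c  ≡⟨ x*s*s≡x (N g c) (sign (span gs b) c) ⟩
    N g c                                      ∎

  independent-∷ : ∀ {k g} (gs : Vec (Fin (suc m)) k) → Independent gs → (∀ a → span gs a ≢ g) → Independent (g ∷ gs)
  independent-∷         gs ind g∉ {false ∷ a} {false ∷ b} e = cong (false ∷_) (ind e)
  independent-∷ {g = g} gs ind g∉ {true ∷ a}  {true ∷ b}  e = cong (true ∷_) (ind (∙-cancelˡ g e))
  independent-∷         gs ind g∉ {false ∷ a} {true ∷ b}  e = ⊥-elim (g∉ _ (span-xor-∙ gs e))
  independent-∷         gs ind g∉ {true ∷ a}  {false ∷ b} e = ⊥-elim (g∉ _ (span-xor-∙ gs (sym e)))

  independent⇒2^k≤n : ∀ {k} (gs : Vec (Fin (suc m)) k) → Independent gs → 2 ^ k ℕ.≤ suc m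
  independent⇒2^k≤n {k} gs ind = injective⇒≤ {f = span gs ∘ decode k} λ {x} {y} e → begin
    x                    ≡⟨ encode-decode k x ⟨
    encode (decode k x)  ≡⟨ cong encode (ind e) ⟩
    encode (decode k y)  ≡⟨ encode-decode k y ⟩
    y                    ∎

  record Basis : Set where
    field
      {rank}      : ℕ
      generators  : Vec (Fin (suc m)) rank
      independent : Independent generators
      spanning    : Spanning generators

  -- Adjoin rows outside the span while there are any; independence bounds the number of steps.
  extend : ∀ fuel {k} (gs : Vec (Fin (suc m)) k) → Independent gs → k ℕ.+ fuel ≡ suc m → Basis
  extend fuel {k} gs ind k+fuel≡n with all? (λ i → any? (λ x → span gs (decode k x) ≟ i))
  ... | yes spans = record { generators = gs ; independent = ind ; spanning = λ i → decode k (proj₁ (spans i)) , proj₂ (spans i) }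
  extend zero    {k} gs ind k+0≡n | no _ =
    ⊥-elim (ℕP.<⇒≱ (n<2^n k) (subst (2 ^ k ℕ.≤_) (trans (sym k+0≡n) (ℕP.+-identityʳ k)) (independent⇒2^k≤n gs ind)))
  extend (suc fuel) {k} gs ind k+fuel≡n | no ¬spans with ¬∀⟶∃¬ (suc m) _ (λ i → any? (λ x → span gs (decode k x) ≟ i)) ¬spans
  ... | g , g∉ = extend fuel (g ∷ gs) (independent-∷ gs ind g∉span) (trans (sym (ℕP.+-suc k fuel)) k+fuel≡n)
    where
    g∉span : ∀ a → span gs a ≢ g
    g∉span a e = g∉ (encode a , trans (cong (span gs) (decode-encode a)) e)

  basis : Basis
  basis = extend (suc m) [] (λ { {[]} {[]} _ → refl }) refl

  module _ (B : Basis) where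
    open Basis B renaming (generators to gs)

    coordinates : Fin (suc m) → Vec Bool rank
    coordinates i = proj₁ (spanning i)

    rowOf : Fin (2 ^ rank) → Fin (suc m)
    rowOf x = span gs (decode rank x)

    rowOf-coordinates : ∀ i → rowOf (encode (coordinates i)) ≡ i
    rowOf-coordinates i = trans (cong (span gs) (decode-encode (coordinates i))) (proj₂ (spanning i))

    rowPermutation : Permutation (2 ^ rank) (suc m)
    rowPermutation = permutation rowOf (encode ∘ coordinates) rowOf-coordinates
      (λ x → trans (cong encode (independent (proj₂ (spanning (rowOf x))))) (encode-decode rank x))

    n≡2^rank : suc m ≡ 2 ^ rank
    n≡2^rank = ℕP.≤-antisym (injective⇒≤ coordinates-injective) (independent⇒2^k≤n gs independent)
      where
      coordinates-injective : Injective _≡_ _≡_ (encode ∘ coordinates)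
      coordinates-injective {i} {j} e = trans (sym (rowOf-coordinates i)) (trans (cong rowOf e) (rowOf-coordinates j))

    columnCode : Fin (suc m) → Fin (2 ^ rank)
    columnCode c = encode (columnBits gs c)

    columnCode-injective : Injective _≡_ _≡_ columnCode
    columnCode-injective {a} {b} e = columns-injective λ l → begin
      N l a                                    ≡⟨ cong (λ i → N i a) (proj₂ (spanning l)) ⟨
      N (span gs (coordinates l)) a            ≡⟨ span-entry gs (coordinates l) a ⟩
      walsh (coordinates l) (columnBits gs a)  ≡⟨ cong (walsh (coordinates l)) bits≡ ⟩
      walsh (coordinates l) (columnBits gs b)  ≡⟨ span-entry gs (coordinates l) b ⟨
      N (span gs (coordinates l)) b            ≡⟨ cong (λ i → N i b) (proj₂ (spanning l)) ⟩
      N l b                                    ∎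
      where
      bits≡ : columnBits gs a ≡ columnBits gs b
      bits≡ = trans (sym (decode-encode (columnBits gs a))) (trans (cong (decode rank) e) (decode-encode (columnBits gs b)))

    columnOf : Fin (2 ^ rank) → Fin (suc m)
    columnOf y = proj₁ (injective⇒surjective columnCode-injective (independent⇒2^k≤n gs independent) y)

    columnCode-columnOf : ∀ y → columnCode (columnOf y) ≡ y
    columnCode-columnOf y = proj₂ (injective⇒surjective columnCode-injective (independent⇒2^k≤n gs independent) y)

    columnPermutation : Permutation (2 ^ rank) (suc m)
    columnPermutation = permutation columnOf columnCode
      (λ c → columnCode-injective (columnCode-columnOf (columnCode c))) columnCode-columnOf

    Sylvester≡N : ∀ x y → Sylvester rank x y ≡ N (rowOf x) (columnOf y)
    Sylvester≡N x y = begin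
      Sylvester rank x y
        ≡⟨ cong₂ (Sylvester rank) (encode-decode rank x) (encode-decode rank y) ⟨
      Sylvester rank (encode (decode rank x)) (encode (decode rank y))
        ≡⟨ Sylvester-encode (decode rank x) (decode rank y) ⟩
      walsh (decode rank x) (decode rank y)
        ≡⟨ cong (walsh (decode rank x)) (trans (sym (decode-encode (columnBits gs (columnOf y)))) (cong (decode rank) (columnCode-columnOf y))) ⟨
      walsh (decode rank x) (columnBits gs (columnOf y))
        ≡⟨ span-entry gs (decode rank x) (columnOf y) ⟨
      N (rowOf x) (columnOf y)
        ∎

    Sylvester-equivalent : Σ ℕ λ r → (suc m ≡ 2 ^ r) × Equivalent N (Sylvester r)
    Sylvester-equivalent = rank , n≡2^rank , rowPermutation , columnPermutation ,
      (λ _ → 1ℤ) , (λ _ → 1ℤ) , (λ _ → inj₁ refl) , (λ _ → inj₁ refl) ,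
      λ x y → trans (Sylvester≡N x y) (sym (ℤP.*-identityˡ _))

normalized-closed⇒Sylvester : ∀ {m} {N : Matrix (suc m)} → IsNormalizedHadamard N → RowsClosed N →
                              Σ ℕ λ r → (suc m ≡ 2 ^ r) × Equivalent N (Sylvester r)
normalized-closed⇒Sylvester isNH closed = Sylvester-equivalent basis
  where open RowGroup isNH closed

P≤n : ∀ {n} {H : Matrix n} → (∀ i j → IsSign (H i j)) → ∀ i j k l → P H i j k l ℕ.≤ n
P≤n {H = H} H± i j k l = subst (ℕ._≤ _) (cong ∣_∣ (sym (Σℤ≡sum (λ r → H i r * H j r * H k r * H l r))))
  (∣sum-signs∣≤n (λ r → sign-* (sign-* (sign-* (H± i r) (H± j r)) (H± k r)) (H± l r)))

type0⇒P≡n : ∀ {n} {H : Matrix n} → (∀ i j → IsSign (H i j)) → ∀ i j k l → HasType H i j k l 0 → P H i j k l ≡ n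
type0⇒P≡n H± i j k l n∸P≡0 = ℕP.≤-antisym (P≤n H± i j k l) (ℕP.m∸n≡0⇒m≤n n∸P≡0)

type-n/8⇒P≡0 : ∀ {m} (H : Matrix (suc m)) i j k l {t} → suc m ≡ 8 ℕ.* t → HasType H i j k l t → P H i j k l ≡ 0
type-n/8⇒P≡0 {m} H i j k l n≡8t n∸P≡8t = n∸p≡n⇒p≡0 (P H i j k l) (trans n∸P≡8t (sym n≡8t))
  where
  n∸p≡n⇒p≡0 : ∀ p → suc m ∸ p ≡ suc m → p ≡ 0
  n∸p≡n⇒p≡0 zero    _ = refl
  n∸p≡n⇒p≡0 (suc p) e = ⊥-elim (ℕP.1+n≰n (subst (ℕ._≤ m) e (ℕP.m∸n≤m m p)))

theorem3p6 : (t : ℕ) → t ℕ.≥ 1 → (H : Matrix (8 ℕ.* t)) → IsHadamard (8 ℕ.* t) H →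
    (∀ i j k l → Distinct4 i j k l → HasType H i j k l 0 ⊎ HasType H i j k l t) →
    Σ ℕ λ r → (8 ℕ.* t ≡ 2 ^ r) × Equivalent H (Sylvester r)
theorem3p6 zero    ()
theorem3p6 (suc t) _ H had@(H± , _) types =
  map₂ (map₂ (normalize-Equivalent H±)) (normalized-closed⇒Sylvester isNH (rowsClosed P∈))
  where
  isNH : IsNormalizedHadamard (normalize H)
  isNH = normalize-isNormalizedHadamard H± (hadamard⇒rowsOrthogonal {H = H} had)
  open NormalizedHadamard isNH using (rowsClosed)
  P∈ : ∀ i j l → Distinct4 zero i j l → P (normalize H) zero i j l ≡ 8 ℕ.* suc t ⊎ P (normalize H) zero i j l ≡ 0
  P∈ i j l distinct = Sum.map (trans (normalize-P H± zero i j l) ∘ type0⇒P≡n H± zero i j l)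
                              (trans (normalize-P H± zero i j l) ∘ type-n/8⇒P≡0 H zero i j l {suc t} refl)
                              (types zero i j l distinct)
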